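{- Let $G$ be a finite group and $H$ a subgroup of $G$. If $H$ has a complement in $G$, i.e., there is a subgroup $K$ with $G=HK$ and $H\cap K=\{e\}$, then $H$ is a perfect code of $G$.
   Context: For an inverse-closed subset $S\subseteq G$ with $e\notin S$, the Cayley graph $\mathrm{Cay}(G,S)$ has vertex set $G$, with distinct $x,y$ adjacent iff $yx^{ -1}\in S$. A subset $C$ of the vertex set of a graph is a perfect code if it is independent and every vertex outside $C$ is adjacent to exactly one vertex of $C$. A subset $C$ of $G$ is a perfect code of $G$ if some Cayley graph $\mathrm{Cay}(G,S)$ (with $S$ possibly empty) admits $C$ as a perfect code. -}

module Defs where

open import Level using (Level; _⊔_; suc)
open import Algebra.Bundles using (Group)
open import Data.Nat using (ℕ)
open import Data.Fin using (Fin)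
open import Data.Product using (Σ; ∃; _×_)
open import Relation.Nullary using (¬_)
open import Relation.Unary using (Pred)

module _ {c ℓ : Level} (G : Group c ℓ) where
  open Group G

  IsFinite : Set (c ⊔ ℓ)
  IsFinite = Σ ℕ λ n → Σ (Fin n → Carrier) λ enum → ∀ g → ∃ λ i → enum i ≈ g

  Respects≈ : {p : Level} → Pred Carrier p → Set (c ⊔ ℓ ⊔ p)
  Respects≈ P = ∀ {x y} → x ≈ y → P x → P y

  record IsSubgroup {p : Level} (H : Pred Carrier p) : Set (c ⊔ ℓ ⊔ p) where
    field
      resp   : Respects≈ H
      has-ε  : H ε
      ∙-closed : ∀ {x y} → H x → H y → H (x ∙ y)
      ⁻¹-closed : ∀ {x} → H x → H (x ⁻¹)

  IsComplement : {p q : Level} → Pred Carrier p → Pred Carrier q → Set (c ⊔ ℓ ⊔ p ⊔ q)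
  IsComplement H K =
    (∀ g → ∃ λ h → ∃ λ k → H h × K k × g ≈ h ∙ k) ×
    (∀ x → H x → K x → x ≈ ε)

  IsConnectionSet : {s : Level} → Pred Carrier s → Set (c ⊔ ℓ ⊔ s)
  IsConnectionSet S = Respects≈ S × (∀ {x} → S x → S (x ⁻¹)) × ¬ S ε

  Adj : {s : Level} → Pred Carrier s → Carrier → Carrier → Set (ℓ ⊔ s)
  Adj S x y = (¬ x ≈ y) × S (y ∙ x ⁻¹)

  IsPerfectCodeIn : {s p : Level} → Pred Carrier s → Pred Carrier p → Set (c ⊔ ℓ ⊔ s ⊔ p)
  IsPerfectCodeIn S C =
    (∀ x y → C x → C y → ¬ Adj S x y) ×
    (∀ v → ¬ C v → ∃ λ x → C x × Adj S v x × (∀ y → C y → Adj S v y → y ≈ x))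

  IsPerfectCodeOfGroup : {p : Level} → Pred Carrier p → Set (suc (c ⊔ ℓ ⊔ p))
  IsPerfectCodeOfGroup {p} C =
    Σ (Pred Carrier (c ⊔ ℓ ⊔ p)) λ S → IsConnectionSet S × IsPerfectCodeIn S C

-- Take the Cayley graph on K ∖ {e}: its connected components are the right
-- cosets K v, each a complete graph.  A set meeting every right coset of K in
-- exactly one element is therefore a perfect code of it, and a subgroup H with
-- G = HK and H ∩ K = {e} is such a set: from v⁻¹ = h k we get h⁻¹ ∈ K v, and two
-- elements x, y of H in one coset give y x⁻¹ ∈ H ∩ K.
module Submission where

open import Defs
open import Level using (Level; Lift; lift; _⊔_)
open import Algebra.Bundles using (Group)
open import Relation.Unary using (Pred)
open import Data.Product using (Σ; ∃; _×_; _,_)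
open import Relation.Nullary using (¬_)
import Algebra.Properties.Group as GroupProperties
import Algebra.Properties.Monoid as MonoidProperties
import Relation.Binary.Reasoning.Setoid as SetoidReasoning

module _ {c ℓ : Level} (G : Group c ℓ) where
  open Group G
  open GroupProperties G
  open MonoidProperties monoid using (cancelˡ)
  open SetoidReasoning setoid

  punctured : {q : Level} → Pred Carrier q → Pred Carrier (c ⊔ ℓ ⊔ q)
  punctured K y = Lift c (K y × ¬ y ≈ ε)

  record IsRightTransversal {p q : Level} (K : Pred Carrier q) (C : Pred Carrier p)
         : Set (c ⊔ ℓ ⊔ p ⊔ q) where
    field
      meets      : ∀ v → ∃ λ x → C x × K (x ∙ v ⁻¹)
      meets-once : ∀ {v x y} → C x → C y → K (x ∙ v ⁻¹) → K (y ∙ v ⁻¹) → y ≈ x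

  ∙-inverse-cancelʳ : ∀ x y v → (y ∙ v ⁻¹) ∙ (x ∙ v ⁻¹) ⁻¹ ≈ y ∙ x ⁻¹
  ∙-inverse-cancelʳ x y v = begin
    (y ∙ v ⁻¹) ∙ (x ∙ v ⁻¹) ⁻¹       ≈⟨ ∙-congˡ (⁻¹-anti-homo-∙ x (v ⁻¹)) ⟩
    (y ∙ v ⁻¹) ∙ (v ⁻¹ ⁻¹ ∙ x ⁻¹)    ≈⟨ assoc y (v ⁻¹) _ ⟩
    y ∙ (v ⁻¹ ∙ (v ⁻¹ ⁻¹ ∙ x ⁻¹))    ≈⟨ ∙-congˡ (cancelˡ (inverseʳ (v ⁻¹)) (x ⁻¹)) ⟩
    y ∙ x ⁻¹                         ∎

  module _ {q : Level} {K : Pred Carrier q} (K-subgroup : IsSubgroup G K) where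
    open IsSubgroup K-subgroup

    sameRightCoset : ∀ {v x y} → K (x ∙ v ⁻¹) → K (y ∙ v ⁻¹) → K (y ∙ x ⁻¹)
    sameRightCoset {v} {x} {y} kx ky = resp (∙-inverse-cancelʳ x y v) (∙-closed ky (⁻¹-closed kx))

    punctured-isConnectionSet : IsConnectionSet G (punctured K)
    punctured-isConnectionSet = respects , inverse-closed , λ { (lift (_ , y≉ε)) → y≉ε refl }
      where
      respects : Respects≈ G (punctured K)
      respects x≈y (lift (kx , x≉ε)) = lift (resp x≈y kx , λ y≈ε → x≉ε (trans x≈y y≈ε))

      inverse-closed : ∀ {y} → punctured K y → punctured K (y ⁻¹)
      inverse-closed {y} (lift (ky , y≉ε)) = lift (⁻¹-closed ky , λ y⁻¹≈ε → y≉ε (begin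
        y         ≈⟨ ⁻¹-involutive y ⟨
        y ⁻¹ ⁻¹   ≈⟨ ⁻¹-cong y⁻¹≈ε ⟩
        ε ⁻¹      ≈⟨ ε⁻¹≈ε ⟩
        ε         ∎))

    rightTransversal⇒perfectCode : {p : Level} {C : Pred Carrier p} → Respects≈ G C →
      IsRightTransversal K C → IsPerfectCodeIn G (punctured K) C
    rightTransversal⇒perfectCode {C = C} C-resp transversal = independent , dominating
      where
      open IsRightTransversal transversal

      independent : ∀ x y → C x → C y → ¬ Adj G (punctured K) x y
      independent x y cx cy (x≉y , lift (k , _)) =
        x≉y (sym (meets-once cx cy (resp (sym (inverseʳ x)) has-ε) k))

      dominating : ∀ v → ¬ C v →
        ∃ λ x → C x × Adj G (punctured K) v x × (∀ y → C y → Adj G (punctured K) v y → y ≈ x)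
      dominating v v∉C with meets v
      ... | x , cx , k =
        x , cx , (v≉x , lift (k , λ e → v≉x (sym (x∙y⁻¹≈ε⇒x≈y x v e)))) ,
        λ { y cy (_ , lift (k′ , _)) → meets-once cx cy k k′ }
        where
        v≉x : ¬ v ≈ x
        v≉x v≈x = v∉C (C-resp (sym v≈x) cx)

  complement⇒rightTransversal : {p q : Level} {H : Pred Carrier p} {K : Pred Carrier q} →
    IsSubgroup G H → IsSubgroup G K → IsComplement G H K → IsRightTransversal K H
  complement⇒rightTransversal {H = H} {K} H-subgroup K-subgroup (H∙K≡G , H∩K≡ε) =
    record { meets = meets ; meets-once = meets-once }
    where
    module H = IsSubgroup H-subgroup
    module K = IsSubgroup K-subgroup

    meets : ∀ v → ∃ λ x → H x × K (x ∙ v ⁻¹)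
    meets v with H∙K≡G (v ⁻¹)
    ... | h , k , hh , kk , v⁻¹≈hk = h ⁻¹ , H.⁻¹-closed hh , K.resp (sym (begin
      h ⁻¹ ∙ v ⁻¹        ≈⟨ ∙-congˡ v⁻¹≈hk ⟩
      h ⁻¹ ∙ (h ∙ k)     ≈⟨ cancelˡ (inverseˡ h) k ⟩
      k                  ∎)) kk

    meets-once : ∀ {v x y} → H x → H y → K (x ∙ v ⁻¹) → K (y ∙ v ⁻¹) → y ≈ x
    meets-once hx hy kx ky = x∙y⁻¹≈ε⇒x≈y _ _
      (H∩K≡ε _ (H.∙-closed hy (H.⁻¹-closed hx)) (sameRightCoset K-subgroup kx ky))

lemma4p3 : {c ℓ p : Level} (G : Group c ℓ) → IsFinite G →
    (H : Pred (Group.Carrier G) p) → IsSubgroup G H →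
    Σ (Pred (Group.Carrier G) p) (λ K → IsSubgroup G K × IsComplement G H K) →
    IsPerfectCodeOfGroup G H
lemma4p3 G _ H H-subgroup (K , K-subgroup , complement) =
  punctured G K ,
  punctured-isConnectionSet G K-subgroup ,
  rightTransversal⇒perfectCode G K-subgroup (IsSubgroup.resp H-subgroup)
    (complement⇒rightTransversal G H-subgroup K-subgroup complement)
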